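{- Let $n, m_1, m_2$ be pairwise coprime positive integers such that $\{\log_2 m_i\} + \{\log_2 n\} \ge 1$ for each $i \in \{1,2\}$ and $\{\log_2 m_1\} + \{\log_2 m_2\} + 2\{\log_2 n\} < 3$. Then \[ \mathsf{D}^{\ast}_{\pm}(C_n \oplus C_{n m_1 m_2}) = \mathsf{D}_{\pm}(C_n \oplus C_{n m_1 m_2}) = \lfloor \log_2 (n^2 m_1 m_2) \rfloor + 1. \]
   Context: $C_m$ denotes a cyclic group of order $m$; $\{x\} = x - \lfloor x\rfloor$ is the fractional part. For a finite abelian group $G$ (written additively), $\mathsf{D}_{\pm}(G)$ is the smallest positive integer $\ell$ such that for every sequence $g_1,\dots,g_k$ of elements of $G$ (repetitions allowed) with $k \ge \ell$ there exist a non-empty subset $I \subset \{1,\dots,k\}$ and $a_i \in \{+1,-1\}$ ($i\in I$) with $\sum_{i \in I} a_i g_i = 0$. Further, $\mathsf{D}^{\ast}_{\pm}(G) = \max\{ \sum_{i=1}^t \lfloor \log_2 m_i \rfloor + 1 \colon G \cong \bigoplus_{i=1}^t C_{m_i},\ t, m_i \in \mathbb{N} \}$. -}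

module Defs where

open import Data.Nat as ℕ using (ℕ; zero; suc; _≤_; _<_; _^_)
open import Data.Nat.Logarithm using (⌊log₂_⌋)
open import Data.Integer as ℤ using (ℤ; +_; 0ℤ)
open import Data.Integer.Divisibility using (_∣_)
open import Data.Fin using (Fin; zero; suc)
open import Data.Bool using (Bool; true; false; if_then_else_)
open import Data.Sign using (Sign)
open import Data.Product using (Σ; ∃; _×_; _,_)
open import Relation.Binary.PropositionalEquality using (_≡_)

ΣFinℕ : (k : ℕ) → (Fin k → ℕ) → ℕ
ΣFinℕ zero    f = 0
ΣFinℕ (suc k) f = f zero ℕ.+ ΣFinℕ k (λ j → f (suc j))

-- The group C_{d_0} ⊕ ... ⊕ C_{d_{s-1}}, given by moduli d : Fin s → ℕ,
-- modelled as the setoid ℤ^s with componentwise congruence mod d_i.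

Elem : ℕ → Set
Elem s = Fin s → ℤ

_≈⟨_⟩_ : {s : ℕ} → Elem s → (Fin s → ℕ) → Elem s → Set
x ≈⟨ d ⟩ y = ∀ i → (+ d i) ∣ (x i ℤ.- y i)

zeroE : {s : ℕ} → Elem s
zeroE i = 0ℤ

_⊕E_ : {s : ℕ} → Elem s → Elem s → Elem s
(x ⊕E y) i = x i ℤ.+ y i

negE : {s : ℕ} → Elem s → Elem s
negE x i = ℤ.- x i

signed : {s : ℕ} → Sign → Elem s → Elem s
signed Sign.+ g = g
signed Sign.- g = negE g

signedSubsum : {s : ℕ} (k : ℕ) → (Fin k → Bool) → (Fin k → Sign) → (Fin k → Elem s) → Elem s
signedSubsum zero    I a g = zeroE
signedSubsum (suc k) I a g =
  (if I zero then signed (a zero) (g zero) else zeroE)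
  ⊕E signedSubsum k (λ j → I (suc j)) (λ j → a (suc j)) (λ j → g (suc j))

AllPMZero : {s : ℕ} → (Fin s → ℕ) → ℕ → Set
AllPMZero {s} d k =
  (g : Fin k → Elem s) →
  Σ (Fin k → Bool) λ I → Σ (Fin k → Sign) λ a →
    (∃ λ j → I j ≡ true) × (signedSubsum k I a g ≈⟨ d ⟩ zeroE)

DpmAdmissible : {s : ℕ} → (Fin s → ℕ) → ℕ → Set
DpmAdmissible d ℓ = 1 ≤ ℓ × (∀ k → ℓ ≤ k → AllPMZero d k)

IsDpm : {s : ℕ} → (Fin s → ℕ) → ℕ → Set
IsDpm d ℓ = DpmAdmissible d ℓ × (∀ ℓ' → DpmAdmissible d ℓ' → ℓ ≤ ℓ')

record GroupIso {s t : ℕ} (d : Fin s → ℕ) (m : Fin t → ℕ) : Set where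
  field
    to   : Elem s → Elem t
    from : Elem t → Elem s
    to-cong   : ∀ x y → x ≈⟨ d ⟩ y → to x ≈⟨ m ⟩ to y
    from-cong : ∀ x y → x ≈⟨ m ⟩ y → from x ≈⟨ d ⟩ from y
    to-hom    : ∀ x y → to (x ⊕E y) ≈⟨ m ⟩ (to x ⊕E to y)
    from-to   : ∀ x → from (to x) ≈⟨ d ⟩ x
    to-from   : ∀ y → to (from y) ≈⟨ m ⟩ y

dstarValue : (t : ℕ) → (Fin t → ℕ) → ℕ
dstarValue t m = ΣFinℕ t (λ i → ⌊log₂ m i ⌋) ℕ.+ 1

Decomposition : {s : ℕ} → (Fin s → ℕ) → (t : ℕ) → (Fin t → ℕ) → Set
Decomposition d t m = 1 ≤ t × (∀ i → 1 ≤ m i) × GroupIso d m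

IsDstar : {s : ℕ} → (Fin s → ℕ) → ℕ → Set
IsDstar d N =
  (Σ ℕ λ t → Σ (Fin t → ℕ) λ m → Decomposition d t m × dstarValue t m ≡ N) ×
  (∀ t (m : Fin t → ℕ) → Decomposition d t m → dstarValue t m ≤ N)

pairMod : ℕ → ℕ → Fin 2 → ℕ
pairMod a b zero       = a
pairMod a b (suc zero) = b

-- Writing
-- {log₂ x} = log₂ x - ⌊log₂ x⌋, for positive integers a, b:
--   {log₂ a} + {log₂ b} ≥ 1  ⇔  log₂(ab) ≥ ⌊log₂ a⌋ + ⌊log₂ b⌋ + 1
--                           ⇔  2^(⌊log₂ a⌋ + ⌊log₂ b⌋ + 1) ≤ a * b
FracSumGe1 : ℕ → ℕ → Set
FracSumGe1 a b = 2 ^ (⌊log₂ a ⌋ ℕ.+ ⌊log₂ b ⌋ ℕ.+ 1) ≤ a ℕ.* b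

-- {log₂ m₁} + {log₂ m₂} + 2{log₂ n} < 3
--   ⇔ m₁ m₂ n² < 2^(⌊log₂ m₁⌋ + ⌊log₂ m₂⌋ + 2⌊log₂ n⌋ + 3)
FracCondLt3 : ℕ → ℕ → ℕ → Set
FracCondLt3 m₁ m₂ n =
  m₁ ℕ.* m₂ ℕ.* (n ℕ.* n) < 2 ^ (⌊log₂ m₁ ⌋ ℕ.+ ⌊log₂ m₂ ⌋ ℕ.+ 2 ℕ.* ⌊log₂ n ⌋ ℕ.+ 3)

{-# OPTIONS --safe #-}
module Submission where

-- By the Chinese remainder theorem C_n ⊕ C_{n m₁ m₂} ≅ C_{n m₁} ⊕ C_{n m₂}, and the
-- fractional-part hypotheses make ⌊log₂ (n m₁)⌋ + ⌊log₂ (n m₂)⌋ = ⌊log₂ (n² m₁ m₂)⌋, so this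
-- decomposition has D*-value L = ⌊log₂ (n² m₁ m₂)⌋ + 1.
-- Every sequence of length k ≥ L in a group of order n² m₁ m₂ < 2^k has a plus-minus weighted
-- zero-subsum: two of its 2^k subset sums coincide, and their difference is a signed subsum.
-- Conversely, in any decomposition ⊕ C_{m_i} the elements 2^j e_i (j < ⌊log₂ m_i⌋) admit no
-- such zero-subsum: a nonempty signed sum of distinct powers 2^j with j < ⌊log₂ m_i⌋ is nonzero
-- and smaller than 2^⌊log₂ m_i⌋ ≤ m_i in absolute value. Hence D*_± ≤ D_± ≤ L ≤ D*_±.

open import Defs hiding (_≈⟨_⟩_)
import Defs
open import Level using (0ℓ)
open import Algebra.Bundles using (Group)
import Algebra.Properties.Group as GroupProperties
open import Data.Nat as ℕ using (ℕ; zero; suc; _≤_; _<_; _^_; ⌊_/2⌋; ⌈_/2⌉; z≤n; s≤s; NonZero)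
import Data.Nat.Properties as ℕ
open import Data.Nat.Divisibility as ℕ using (_∣0; >⇒∤)
open import Data.Nat.Coprimality using (Coprime; coprime-Bézout)
open import Data.Nat.GCD using (module Bézout)
open import Data.Nat.Induction using (<-rec)
open import Data.Nat.Logarithm using (⌊log₂_⌋; ⌊log₂⌋-mono-≤; ⌊log₂[2^n]⌋≡n)
open import Data.Nat.Logarithm.Core using (⌊log2⌋-acc-irrelevant)
open import Data.Integer as ℤ using (ℤ; +_; 0ℤ; 1ℤ; -1ℤ; ∣_∣)
import Data.Integer.Properties as ℤ
open import Data.Integer.Divisibility using (_∣_)
import Data.Integer.Divisibility.Signed as Signed
open import Data.Integer.Tactic.RingSolver using (solve-∀)
open import Data.Integer.DivMod using (_%ℕ_; _/ℕ_; n%ℕd<d; a≡a%ℕn+[a/ℕn]*n)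
open import Data.Fin as Fin
  using (Fin; zero; suc; toℕ; fromℕ<; _↑ˡ_; _↑ʳ_; splitAt; combine; finToFun; funToFin)
open import Data.Fin.Properties
  using ( splitAt⁻¹-↑ˡ; splitAt⁻¹-↑ʳ; pigeonhole; combine-injective; toℕ-fromℕ<
        ; funToFin-finToFin; ¬∀⟶∃¬; 2↔Bool)
import Data.Fin.Properties as Fin
open import Data.Vec.Functional using (_++_; replicate)
open import Data.Vec.Functional.Properties using (lookup-++ˡ; lookup-++ʳ)
open import Data.Bool using (Bool; true; false; if_then_else_; _xor_)
import Data.Bool.Properties as Bool
open import Data.Sign using (Sign)
open import Data.Sum using (inj₁; inj₂)
open import Data.Product using (∃; ∃₂; _×_; _,_)
open import Function using (_∘_; Inverse; Injection)
open import Function.Properties.Inverse using (Inverse⇒Injection)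
open import Relation.Nullary using (¬_; yes; no; contradiction)
open import Relation.Binary.PropositionalEquality as ≡ using (_≡_; _≢_; cong; cong₂)
import Relation.Binary.Reasoning.Setoid as SetoidReasoning

⌊log₂[2+n]⌋≡1+⌊log₂⌊[2+n]/2⌋⌋ : ∀ n → ⌊log₂ (2 ℕ.+ n) ⌋ ≡ 1 ℕ.+ ⌊log₂ ⌊ 2 ℕ.+ n /2⌋ ⌋
⌊log₂[2+n]⌋≡1+⌊log₂⌊[2+n]/2⌋⌋ n = cong suc (⌊log2⌋-acc-irrelevant (suc ⌊ n /2⌋))

2^⌊log₂n⌋≤n : ∀ n → 1 ≤ n → 2 ^ ⌊log₂ n ⌋ ≤ n
2^⌊log₂n⌋≤n = <-rec _ step
  where
  step : ∀ n → (∀ {m} → m < n → 1 ≤ m → 2 ^ ⌊log₂ m ⌋ ≤ m) → 1 ≤ n → 2 ^ ⌊log₂ n ⌋ ≤ n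
  step 1             _   _ = ℕ.≤-refl
  step (suc (suc k)) rec _ = begin
    2 ^ ⌊log₂ n ⌋         ≡⟨ cong (2 ^_) (⌊log₂[2+n]⌋≡1+⌊log₂⌊[2+n]/2⌋⌋ k) ⟩
    2 ℕ.* 2 ^ ⌊log₂ h ⌋   ≤⟨ ℕ.*-monoʳ-≤ 2 (rec (ℕ.⌊n/2⌋<n (suc k)) (s≤s z≤n)) ⟩
    h ℕ.+ (h ℕ.+ 0)       ≡⟨ cong (h ℕ.+_) (ℕ.+-identityʳ h) ⟩
    h ℕ.+ h               ≤⟨ ℕ.+-monoʳ-≤ h (ℕ.⌊n/2⌋≤⌈n/2⌉ n) ⟩
    h ℕ.+ ⌈ n /2⌉         ≡⟨ ℕ.⌊n/2⌋+⌈n/2⌉≡n n ⟩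
    n                     ∎
    where
    open ℕ.≤-Reasoning
    n h : ℕ
    n = 2 ℕ.+ k
    h = ⌊ n /2⌋

n<2^[1+⌊log₂n⌋] : ∀ n → n < 2 ^ suc ⌊log₂ n ⌋
n<2^[1+⌊log₂n⌋] n = ℕ.≰⇒> λ 2^[1+⌊log₂n⌋]≤n → ℕ.1+n≰n (begin
  suc ⌊log₂ n ⌋                 ≡⟨ ⌊log₂[2^n]⌋≡n (suc ⌊log₂ n ⌋) ⟨
  ⌊log₂ (2 ^ suc ⌊log₂ n ⌋) ⌋   ≤⟨ ⌊log₂⌋-mono-≤ 2^[1+⌊log₂n⌋]≤n ⟩
  ⌊log₂ n ⌋                     ∎)
  where open ℕ.≤-Reasoning

⌊log₂⌋-unique : ∀ {k n} → 2 ^ k ≤ n → n < 2 ^ suc k → ⌊log₂ n ⌋ ≡ k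
⌊log₂⌋-unique {k} {n} 2^k≤n n<2^[1+k] = ℕ.≤-antisym ⌊log₂n⌋≤k k≤⌊log₂n⌋
  where
  k≤⌊log₂n⌋ : k ≤ ⌊log₂ n ⌋
  k≤⌊log₂n⌋ = ≡.subst (_≤ ⌊log₂ n ⌋) (⌊log₂[2^n]⌋≡n k) (⌊log₂⌋-mono-≤ 2^k≤n)
  ⌊log₂n⌋≤k : ⌊log₂ n ⌋ ≤ k
  ⌊log₂n⌋≤k = ℕ.≮⇒≥ λ k<⌊log₂n⌋ → ℕ.<⇒≱ n<2^[1+k]
    (ℕ.≤-trans (ℕ.^-monoʳ-≤ 2 k<⌊log₂n⌋) (2^⌊log₂n⌋≤n n (ℕ.≤-trans (ℕ.m^n>0 2 k) 2^k≤n)))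

module Divisibility where

  open import Data.Integer using (_+_; _-_; -_; _*_)

  ∣-resp : ∀ {n a b} → a ≡ b → + n ∣ a → + n ∣ b
  ∣-resp {n} = ≡.subst (λ c → + n ∣ c)

  ∣-+ : ∀ {n} a b → + n ∣ a → + n ∣ b → + n ∣ a + b
  ∣-+ {n} a b n∣a n∣b =
    Signed.∣⇒∣ᵤ (Signed.∣m∣n⇒∣m+n (Signed.∣ᵤ⇒∣ {+ n} {a} n∣a) (Signed.∣ᵤ⇒∣ {+ n} {b} n∣b))

  ∣-neg : ∀ {n} a → + n ∣ a → + n ∣ - a
  ∣-neg {n} a = ≡.subst (n ℕ.∣_) (≡.sym (ℤ.∣-i∣≡∣i∣ a))

  ∣-witness : ∀ {d} D → + d ≡ D → ∀ {x} q → x ≡ q * D → + d ∣ x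
  ∣-witness D ≡.refl {x} q x≡qD = Signed.∣⇒∣ᵤ {D} {x} (Signed.divides q x≡qD)

  quotient : ∀ {d} D → + d ≡ D → ∀ x → + d ∣ x → ∃ λ q → x ≡ q * D
  quotient D ≡.refl x d∣x with Signed.divides q x≡qD ← Signed.∣ᵤ⇒∣ {D} {x} d∣x = q , x≡qD

  ∣-small⇒≡0 : ∀ {m x} → + m ∣ x → ∣ x ∣ < m → x ≡ 0ℤ
  ∣-small⇒≡0 {m} {x} m∣x ∣x∣<m with ∣ x ∣ ℕ.≟ 0
  ... | yes ∣x∣≡0 = ℤ.∣i∣≡0⇒i≡0 ∣x∣≡0
  ... | no  ∣x∣≢0 = contradiction m∣x (>⇒∤ {{ℕ.≢-nonZero ∣x∣≢0}} ∣x∣<m)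

  residue : (d : ℕ) .{{_ : NonZero d}} → ℤ → Fin d
  residue d x = fromℕ< (n%ℕd<d x d)

  residue-≡⇒∣ : ∀ d .{{_ : NonZero d}} x y → residue d x ≡ residue d y → + d ∣ x - y
  residue-≡⇒∣ d x y same = ∣-witness (+ d) ≡.refl (x /ℕ d - y /ℕ d) (begin
    x - y
      ≡⟨ cong₂ _-_ (a≡a%ℕn+[a/ℕn]*n x d) (a≡a%ℕn+[a/ℕn]*n y d) ⟩
    (+ (x %ℕ d) + x /ℕ d * + d) - (+ (y %ℕ d) + y /ℕ d * + d)
      ≡⟨ cong (λ r → (+ (x %ℕ d) + x /ℕ d * + d) - (+ r + y /ℕ d * + d)) x%d≡y%d ⟨
    (+ (x %ℕ d) + x /ℕ d * + d) - (+ (x %ℕ d) + y /ℕ d * + d)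
      ≡⟨ cancel (+ (x %ℕ d)) (x /ℕ d) (y /ℕ d) (+ d) ⟩
    (x /ℕ d - y /ℕ d) * + d ∎)
    where
    open ≡.≡-Reasoning
    x%d≡y%d : x %ℕ d ≡ y %ℕ d
    x%d≡y%d = ≡.trans (≡.sym (toℕ-fromℕ< _)) (≡.trans (cong toℕ same) (toℕ-fromℕ< _))
    cancel : ∀ r p q e → (r + p * e) - (r + q * e) ≡ (p - q) * e
    cancel = solve-∀

  ℕ-Bézout⇒ℤ : ∀ x y a b → 1 ℕ.+ y ℕ.* b ≡ x ℕ.* a → + x * + a - + y * + b ≡ 1ℤ
  ℕ-Bézout⇒ℤ x y a b eq = begin
    + x * + a - + y * + b             ≡⟨ cong₂ _-_ (ℤ.pos-* x a) (ℤ.pos-* y b) ⟨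
    + (x ℕ.* a) - + (y ℕ.* b)         ≡⟨ cong (λ z → + z - + (y ℕ.* b)) eq ⟨
    + (1 ℕ.+ y ℕ.* b) - + (y ℕ.* b)   ≡⟨ cong (_- + (y ℕ.* b)) (ℤ.pos-+ 1 (y ℕ.* b)) ⟩
    1ℤ + + (y ℕ.* b) - + (y ℕ.* b)    ≡⟨ cancel 1ℤ (+ (y ℕ.* b)) ⟩
    1ℤ                                ∎
    where
    open ≡.≡-Reasoning
    cancel : ∀ p q → p + q - q ≡ p
    cancel = solve-∀

  coprime-Bézoutℤ : ∀ {a b} → Coprime a b → ∃₂ λ α β → α * + a + β * + b ≡ 1ℤ
  coprime-Bézoutℤ {a} {b} a⊥b with coprime-Bézout a⊥b
  ... | Bézout.+- x y 1+yb≡xa =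
    + x , - + y , ≡.trans (regroup (+ x) (+ a) (+ y) (+ b)) (ℕ-Bézout⇒ℤ x y a b 1+yb≡xa)
    where
    regroup : ∀ x a y b → x * a + - y * b ≡ x * a - y * b
    regroup = solve-∀
  ... | Bézout.-+ x y 1+xa≡yb =
    - + x , + y , ≡.trans (regroup (+ x) (+ a) (+ y) (+ b)) (ℕ-Bézout⇒ℤ y x b a 1+xa≡yb)
    where
    regroup : ∀ x a y b → - x * a + y * b ≡ y * b - x * a
    regroup = solve-∀

open Divisibility

module CyclicSum {s : ℕ} (d : Fin s → ℕ) where

  open import Data.Integer using (_+_; _-_; -_)

  -- A record rather than the bare componentwise relation, so that x and y can be
  -- inferred from a proof of x ≈ y.
  infix 4 _≈_
  record _≈_ (x y : Elem s) : Set where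
    constructor congruent
    field componentwise : x Defs.≈⟨ d ⟩ y
  open _≈_ public

  ≈-pointwise : ∀ {x y} → (∀ i → x i ≡ y i) → x ≈ y
  ≈-pointwise {x} x≗y = congruent λ i →
    ∣-resp (≡.trans (≡.sym (ℤ.+-inverseʳ (x i))) (cong (λ z → x i - z) (x≗y i))) (_ ∣0)

  ≈-sym : ∀ {x y} → x ≈ y → y ≈ x
  ≈-sym {x} {y} (congruent x≈y) = congruent λ i →
    ∣-resp (negate (x i) (y i)) (∣-neg (x i - y i) (x≈y i))
    where
    negate : ∀ a b → - (a - b) ≡ b - a
    negate = solve-∀

  ≈-trans : ∀ {x y z} → x ≈ y → y ≈ z → x ≈ z
  ≈-trans {x} {y} {z} (congruent x≈y) (congruent y≈z) = congruent λ i →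
    ∣-resp (telescope (x i) (y i) (z i)) (∣-+ (x i - y i) (y i - z i) (x≈y i) (y≈z i))
    where
    telescope : ∀ a b c → (a - b) + (b - c) ≡ a - c
    telescope = solve-∀

  ⊕-cong : ∀ {x y u v} → x ≈ y → u ≈ v → (x ⊕E u) ≈ (y ⊕E v)
  ⊕-cong {x} {y} {u} {v} (congruent x≈y) (congruent u≈v) = congruent λ i →
    ∣-resp (regroup (x i) (y i) (u i) (v i)) (∣-+ (x i - y i) (u i - v i) (x≈y i) (u≈v i))
    where
    regroup : ∀ a b c e → (a - b) + (c - e) ≡ (a + c) - (b + e)
    regroup = solve-∀

  neg-cong : ∀ {x y} → x ≈ y → negE x ≈ negE y
  neg-cong {x} {y} (congruent x≈y) = congruent λ i →
    ∣-resp (negate (x i) (y i)) (∣-neg (x i - y i) (x≈y i))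
    where
    negate : ∀ a b → - (a - b) ≡ - a - - b
    negate = solve-∀

  group : Group 0ℓ 0ℓ
  group = record
    { Carrier = Elem s
    ; _≈_     = _≈_
    ; _∙_     = _⊕E_
    ; ε       = zeroE
    ; _⁻¹     = negE
    ; isGroup = record
      { isMonoid = record
        { isSemigroup = record
          { isMagma = record
            { isEquivalence = record
              { refl = ≈-pointwise (λ _ → ≡.refl) ; sym = ≈-sym ; trans = ≈-trans }
            ; ∙-cong = ⊕-cong
            }
          ; assoc = λ x y z → ≈-pointwise (λ i → ℤ.+-assoc (x i) (y i) (z i))
          }
        ; identity = (λ x → ≈-pointwise (ℤ.+-identityˡ ∘ x))
                   , (λ x → ≈-pointwise (ℤ.+-identityʳ ∘ x))
        }
      ; inverse = (λ x → ≈-pointwise (ℤ.+-inverseˡ ∘ x))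
                , (λ x → ≈-pointwise (ℤ.+-inverseʳ ∘ x))
      ; ⁻¹-cong = neg-cong
      }
    }

  open Group group public using (setoid; identityˡ; inverseʳ) renaming (refl to ≈-refl)
  open GroupProperties group public using (identityˡ-unique; inverseʳ-unique)

  signedTerm-cong : ∀ b σ {x y} → x ≈ y →
    (if b then signed σ x else zeroE) ≈ (if b then signed σ y else zeroE)
  signedTerm-cong false σ      _   = ≈-refl
  signedTerm-cong true  Sign.+ x≈y = x≈y
  signedTerm-cong true  Sign.- x≈y = neg-cong x≈y

  signedSubsum-cong : ∀ k I a {g h : Fin k → Elem s} → (∀ j → g j ≈ h j) →
    signedSubsum k I a g ≈ signedSubsum k I a h
  signedSubsum-cong zero    I a g≈h = ≈-refl
  signedSubsum-cong (suc k) I a g≈h =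
    ⊕-cong (signedTerm-cong (I zero) (a zero) (g≈h zero))
           (signedSubsum-cong k (I ∘ suc) (a ∘ suc) (g≈h ∘ suc))

module AdditiveMap {s t : ℕ} {d : Fin s → ℕ} {m : Fin t → ℕ} (f : Elem s → Elem t)
  (f-cong : ∀ x y → x Defs.≈⟨ d ⟩ y → f x Defs.≈⟨ m ⟩ f y)
  (f-hom  : ∀ x y → f (x ⊕E y) Defs.≈⟨ m ⟩ (f x ⊕E f y)) where

  private
    module G = CyclicSum d
    module H = CyclicSum m
  open SetoidReasoning H.setoid

  f-zero : f zeroE H.≈ zeroE
  f-zero = H.identityˡ-unique (f zeroE) (f zeroE) (begin
    f zeroE ⊕E f zeroE  ≈⟨ H.≈-sym (H.congruent (f-hom zeroE zeroE)) ⟩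
    f (zeroE ⊕E zeroE)  ≈⟨ H.congruent (f-cong _ _ (G.componentwise (G.identityˡ zeroE))) ⟩
    f zeroE             ∎)

  f-neg : ∀ x → f (negE x) H.≈ negE (f x)
  f-neg x = H.inverseʳ-unique (f x) (f (negE x)) (begin
    f x ⊕E f (negE x)  ≈⟨ H.≈-sym (H.congruent (f-hom x (negE x))) ⟩
    f (x ⊕E negE x)    ≈⟨ H.congruent (f-cong _ _ (G.componentwise (G.inverseʳ x))) ⟩
    f zeroE            ≈⟨ f-zero ⟩
    zeroE              ∎)

  f-signedTerm : ∀ b σ x →
    f (if b then signed σ x else zeroE) H.≈ (if b then signed σ (f x) else zeroE)
  f-signedTerm false σ      x = f-zero
  f-signedTerm true  Sign.+ x = H.≈-refl
  f-signedTerm true  Sign.- x = f-neg x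

  f-signedSubsum : ∀ k I a (g : Fin k → Elem s) →
    f (signedSubsum k I a g) H.≈ signedSubsum k I a (f ∘ g)
  f-signedSubsum zero    I a g = f-zero
  f-signedSubsum (suc k) I a g = H.≈-trans (H.congruent (f-hom _ _))
    (H.⊕-cong (f-signedTerm (I zero) (a zero) (g zero))
              (f-signedSubsum k (I ∘ suc) (a ∘ suc) (g ∘ suc)))

AllPMZero-transport : ∀ {s t} {d : Fin s → ℕ} {m : Fin t → ℕ} {k} →
  GroupIso d m → AllPMZero d k → AllPMZero m k
AllPMZero-transport {m = m} {k} φ allZero g
  with I , a , nonempty , sum≈0 ← allZero (GroupIso.from φ ∘ g)
  = I , a , nonempty , H.componentwise (begin
      signedSubsum k I a g
        ≈⟨ H.signedSubsum-cong k I a (H.≈-sym ∘ H.congruent ∘ to-from ∘ g) ⟩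
      signedSubsum k I a (to ∘ from ∘ g)
        ≈⟨ H.≈-sym (f-signedSubsum k I a (from ∘ g)) ⟩
      to (signedSubsum k I a (from ∘ g))
        ≈⟨ H.congruent (to-cong _ _ sum≈0) ⟩
      to zeroE
        ≈⟨ f-zero ⟩
      zeroE ∎)
  where
  open GroupIso φ
  open AdditiveMap to to-cong to-hom
  module H = CyclicSum m
  open SetoidReasoning H.setoid

PMZeroSumFree : ∀ {s k} → (Fin s → ℕ) → (Fin k → Elem s) → Set
PMZeroSumFree {k = k} d g =
  ∀ I a → (∃ λ j → I j ≡ true) → ¬ (signedSubsum k I a g Defs.≈⟨ d ⟩ zeroE)

PMZeroSumFree⇒¬AllPMZero : ∀ {s k} {d : Fin s → ℕ} (g : Fin k → Elem s) →
  PMZeroSumFree d g → ¬ AllPMZero d k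
PMZeroSumFree⇒¬AllPMZero g free allZero =
  let I , a , nonempty , sum≈0 = allZero g in free I a nonempty sum≈0

module SignedSums where

  open import Data.Integer using (_+_; _-_; _*_)
  open import Algebra.Properties.Semiring.Sum ℤ.+-*-semiring public
    using (sum-syntax; sum-cong-≗; sum-replicate-zero; *-distribˡ-sum)

  coefficient : Bool → Sign → ℤ
  coefficient false _      = 0ℤ
  coefficient true  Sign.+ = 1ℤ
  coefficient true  Sign.- = -1ℤ

  ∣coefficient∣≤1 : ∀ b σ → ∣ coefficient b σ ∣ ≤ 1
  ∣coefficient∣≤1 false _      = z≤n
  ∣coefficient∣≤1 true  Sign.+ = ℕ.≤-refl
  ∣coefficient∣≤1 true  Sign.- = ℕ.≤-refl

  coefficient≢0 : ∀ {b} σ → b ≡ true → coefficient b σ ≢ 0ℤ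
  coefficient≢0 Sign.+ ≡.refl ()
  coefficient≢0 Sign.- ≡.refl ()

  coefficient-xor : ∀ b c →
    coefficient (b xor c) (if b then Sign.+ else Sign.-) ≡ coefficient b Sign.+ - coefficient c Sign.+
  coefficient-xor true  true  = ≡.refl
  coefficient-xor true  false = ≡.refl
  coefficient-xor false true  = ≡.refl
  coefficient-xor false false = ≡.refl

  signedTerm-component : ∀ {s} b σ (x : Elem s) c →
    (if b then signed σ x else zeroE) c ≡ coefficient b σ * x c
  signedTerm-component false σ      x c = ≡.sym (ℤ.*-zeroˡ (x c))
  signedTerm-component true  Sign.+ x c = ≡.sym (ℤ.*-identityˡ (x c))
  signedTerm-component true  Sign.- x c = ≡.sym (ℤ.-1*i≡-i (x c))

  signedSubsum-component : ∀ {s} k I a (g : Fin k → Elem s) c →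
    signedSubsum k I a g c ≡ ∑[ j < k ] (coefficient (I j) (a j) * g j c)
  signedSubsum-component zero    I a g c = ≡.refl
  signedSubsum-component (suc k) I a g c =
    cong₂ _+_ (signedTerm-component (I zero) (a zero) (g zero) c)
              (signedSubsum-component k (I ∘ suc) (a ∘ suc) (g ∘ suc) c)

  ∑-split : ∀ a b (v : Fin (a ℕ.+ b) → ℤ) →
    ∑[ j < a ℕ.+ b ] v j ≡ ∑[ j < a ] v (j ↑ˡ b) + ∑[ j < b ] v (a ↑ʳ j)
  ∑-split zero    b v = ≡.sym (ℤ.+-identityˡ _)
  ∑-split (suc a) b v = ≡.trans (cong (λ z → v zero + z) (∑-split a b (v ∘ suc)))
    (≡.sym (ℤ.+-assoc (v zero) _ _))

  ∑-*0 : ∀ k (c : Fin k → ℤ) → ∑[ j < k ] (c j * 0ℤ) ≡ 0ℤ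
  ∑-*0 k c = ≡.trans (sum-cong-≗ (ℤ.*-zeroʳ ∘ c)) (sum-replicate-zero k)

  ∑-*-++ : ∀ a b (c : Fin (a ℕ.+ b) → ℤ) (u : Fin a → ℤ) (v : Fin b → ℤ) →
    ∑[ j < a ℕ.+ b ] (c j * (u ++ v) j) ≡ ∑[ j < a ] (c (j ↑ˡ b) * u j) + ∑[ j < b ] (c (a ↑ʳ j) * v j)
  ∑-*-++ a b c u v = ≡.trans (∑-split a b (λ j → c j * (u ++ v) j)) (cong₂ _+_
    (sum-cong-≗ λ j → cong (c (j ↑ˡ b) *_) (lookup-++ˡ u v j))
    (sum-cong-≗ λ j → cong (c (a ↑ʳ j) *_) (lookup-++ʳ u v j)))

  ∑-distrib-- : ∀ k (p q x : Fin k → ℤ) →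
    ∑[ j < k ] ((p j - q j) * x j) ≡ ∑[ j < k ] (p j * x j) - ∑[ j < k ] (q j * x j)
  ∑-distrib-- zero    p q x = ≡.refl
  ∑-distrib-- (suc k) p q x =
    ≡.trans (cong (λ z → (p zero - q zero) * x zero + z) (∑-distrib-- k (p ∘ suc) (q ∘ suc) (x ∘ suc)))
            (regroup (p zero) (q zero) (x zero) _ _)
    where
    regroup : ∀ a b y A B → (a - b) * y + (A - B) ≡ (a * y + A) - (b * y + B)
    regroup = solve-∀

  subsum : ∀ {s} k → (Fin k → Bool) → (Fin k → Elem s) → Elem s
  subsum k S = signedSubsum k S (λ _ → Sign.+)

  signedSubsum-xor : ∀ {s} k S T (g : Fin k → Elem s) c →
    signedSubsum k (λ j → S j xor T j) (λ j → if S j then Sign.+ else Sign.-) g c ≡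
    subsum k S g c - subsum k T g c
  signedSubsum-xor k S T g c = begin
    signedSubsum k (λ j → S j xor T j) (λ j → if S j then Sign.+ else Sign.-) g c
      ≡⟨ signedSubsum-component k _ _ g c ⟩
    ∑[ j < k ] (coefficient (S j xor T j) (if S j then Sign.+ else Sign.-) * g j c)
      ≡⟨ sum-cong-≗ (λ j → cong (_* g j c) (coefficient-xor (S j) (T j))) ⟩
    ∑[ j < k ] ((coefficient (S j) Sign.+ - coefficient (T j) Sign.+) * g j c)
      ≡⟨ ∑-distrib-- k (λ j → coefficient (S j) Sign.+) (λ j → coefficient (T j) Sign.+) (λ j → g j c) ⟩
    ∑[ j < k ] (coefficient (S j) Sign.+ * g j c) - ∑[ j < k ] (coefficient (T j) Sign.+ * g j c)
      ≡⟨ cong₂ _-_ (signedSubsum-component k S _ g c) (signedSubsum-component k T _ g c) ⟨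
    subsum k S g c - subsum k T g c ∎
    where open ≡.≡-Reasoning

open SignedSums

module PowersOfTwo where

  open import Data.Integer using (_+_; _-_; -_; _*_)

  powersOfTwo : (k : ℕ) → Fin k → ℤ
  powersOfTwo k j = + (2 ^ toℕ j)

  fromBinary : (k : ℕ) → (Fin k → ℤ) → ℤ
  fromBinary k c = ∑[ j < k ] (c j * powersOfTwo k j)

  fromBinary-suc : ∀ k c → fromBinary (suc k) c ≡ c zero + + 2 * fromBinary k (c ∘ suc)
  fromBinary-suc k c = cong₂ _+_ (ℤ.*-identityʳ (c zero)) (begin
    ∑[ j < k ] (c (suc j) * + (2 ℕ.* 2 ^ toℕ j))
      ≡⟨ sum-cong-≗ (λ j → regroup (c (suc j)) (2 ^ toℕ j)) ⟩
    ∑[ j < k ] (+ 2 * (c (suc j) * powersOfTwo k j))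
      ≡⟨ *-distribˡ-sum (+ 2) (λ j → c (suc j) * powersOfTwo k j) ⟨
    + 2 * fromBinary k (c ∘ suc) ∎)
    where
    open ≡.≡-Reasoning
    regroup : ∀ x n → x * + (2 ℕ.* n) ≡ + 2 * (x * + n)
    regroup x n = ≡.trans (cong (x *_) (ℤ.pos-* 2 n)) (commute x (+ n))
      where
      commute : ∀ x y → x * (+ 2 * y) ≡ + 2 * (x * y)
      commute = solve-∀

  ∣fromBinary∣<2^k : ∀ k c → (∀ j → ∣ c j ∣ ≤ 1) → ∣ fromBinary k c ∣ < 2 ^ k
  ∣fromBinary∣<2^k zero    c ∣c∣≤1 = s≤s z≤n
  ∣fromBinary∣<2^k (suc k) c ∣c∣≤1 = begin-strict
    ∣ fromBinary (suc k) c ∣      ≡⟨ cong ∣_∣ (fromBinary-suc k c) ⟩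
    ∣ c zero + + 2 * P ∣          ≤⟨ ℤ.∣i+j∣≤∣i∣+∣j∣ (c zero) (+ 2 * P) ⟩
    ∣ c zero ∣ ℕ.+ ∣ + 2 * P ∣    ≡⟨ cong (∣ c zero ∣ ℕ.+_) (ℤ.abs-* (+ 2) P) ⟩
    ∣ c zero ∣ ℕ.+ 2 ℕ.* ∣ P ∣    ≤⟨ ℕ.+-monoˡ-≤ _ (∣c∣≤1 zero) ⟩
    1 ℕ.+ 2 ℕ.* ∣ P ∣             <⟨ ℕ.n<1+n _ ⟩
    2 ℕ.+ 2 ℕ.* ∣ P ∣             ≡⟨ ℕ.*-suc 2 ∣ P ∣ ⟨
    2 ℕ.* suc ∣ P ∣               ≤⟨ ℕ.*-monoʳ-≤ 2 (∣fromBinary∣<2^k k (c ∘ suc) (∣c∣≤1 ∘ suc)) ⟩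
    2 ^ suc k                     ∎
    where
    open ℕ.≤-Reasoning
    P : ℤ
    P = fromBinary k (c ∘ suc)

  -- Writing the sum as c₀ + 2 P: if c₀ = ±1 the sum is odd, and if c₀ = 0 then P ≠ 0.
  fromBinary≢0 : ∀ k c → (∀ j → ∣ c j ∣ ≤ 1) → (∃ λ j → c j ≢ 0ℤ) → fromBinary k c ≢ 0ℤ
  fromBinary≢0 (suc k) c ∣c∣≤1 (j , cj≢0) sum≡0 with c zero ℤ.≟ 0ℤ
  ... | yes c₀≡0 = fromBinary≢0 k (c ∘ suc) (∣c∣≤1 ∘ suc) (tail-witness j cj≢0) P≡0
    where
    P : ℤ
    P = fromBinary k (c ∘ suc)
    tail-witness : ∀ j → c j ≢ 0ℤ → ∃ λ j → c (suc j) ≢ 0ℤ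
    tail-witness zero    c₀≢0 = contradiction c₀≡0 c₀≢0
    tail-witness (suc j) cj≢0 = j , cj≢0
    P≡0 : P ≡ 0ℤ
    P≡0 = ℤ.*-cancelˡ-≡ (+ 2) P 0ℤ (begin
      + 2 * P              ≡⟨ ℤ.+-identityˡ (+ 2 * P) ⟨
      0ℤ + + 2 * P         ≡⟨ cong (λ z → z + + 2 * P) c₀≡0 ⟨
      c zero + + 2 * P     ≡⟨ fromBinary-suc k c ⟨
      fromBinary (suc k) c ≡⟨ sum≡0 ⟩
      0ℤ                   ∎)
      where open ≡.≡-Reasoning
  ... | no  c₀≢0 = contradiction (ℕ.m*n≡1⇒m≡1 2 ∣ P ∣ 2∣P∣≡1) λ ()
    where
    P : ℤ
    P = fromBinary k (c ∘ suc)
    c₀+2P≡0 : c zero + + 2 * P ≡ 0ℤ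
    c₀+2P≡0 = ≡.trans (≡.sym (fromBinary-suc k c)) sum≡0
    ∣c₀∣≡1 : ∣ c zero ∣ ≡ 1
    ∣c₀∣≡1 = ℕ.≤-antisym (∣c∣≤1 zero) (ℕ.n≢0⇒n>0 (c₀≢0 ∘ ℤ.∣i∣≡0⇒i≡0))
    2∣P∣≡1 : 2 ℕ.* ∣ P ∣ ≡ 1
    2∣P∣≡1 = begin
      2 ℕ.* ∣ P ∣                     ≡⟨ ℤ.abs-* (+ 2) P ⟨
      ∣ + 2 * P ∣                     ≡⟨ cong ∣_∣ (isolate (c zero) (+ 2 * P)) ⟩
      ∣ (c zero + + 2 * P) - c zero ∣ ≡⟨ cong (λ z → ∣ z - c zero ∣) c₀+2P≡0 ⟩
      ∣ 0ℤ - c zero ∣                 ≡⟨ cong ∣_∣ (ℤ.+-identityˡ (- c zero)) ⟩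
      ∣ - c zero ∣                    ≡⟨ ℤ.∣-i∣≡∣i∣ (c zero) ⟩
      ∣ c zero ∣                      ≡⟨ ∣c₀∣≡1 ⟩
      1                               ∎
      where
      open ≡.≡-Reasoning
      isolate : ∀ x y → y ≡ (x + y) - x
      isolate = solve-∀

  binaryLength : (t : ℕ) → (Fin t → ℕ) → ℕ
  binaryLength t m = ΣFinℕ t (λ i → ⌊log₂ m i ⌋)

  -- The elements 2^j e_i (j < ⌊log₂ m_i⌋) of ⊕ C_{m_i}, listed block by block.
  binarySequence : ∀ t (m : Fin t → ℕ) → Fin (binaryLength t m) → Elem t
  binarySequence (suc t) m j zero    = (powersOfTwo ⌊log₂ m zero ⌋ ++ replicate _ 0ℤ) j
  binarySequence (suc t) m j (suc i) =
    (replicate ⌊log₂ m zero ⌋ 0ℤ ++ λ j → binarySequence t (m ∘ suc) j i) j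

  module _ (t : ℕ) (m : Fin (suc t) → ℕ) (I : Fin (binaryLength (suc t) m) → Bool)
           (a : Fin (binaryLength (suc t) m) → Sign) where

    private
      L R : ℕ
      L = ⌊log₂ m zero ⌋
      R = binaryLength t (m ∘ suc)
      c : Fin (L ℕ.+ R) → ℤ
      c j = coefficient (I j) (a j)

    binarySequence-head : signedSubsum (L ℕ.+ R) I a (binarySequence (suc t) m) zero ≡
                          fromBinary L (c ∘ (_↑ˡ R))
    binarySequence-head = begin
      signedSubsum (L ℕ.+ R) I a (binarySequence (suc t) m) zero
        ≡⟨ signedSubsum-component (L ℕ.+ R) I a _ zero ⟩
      ∑[ j < L ℕ.+ R ] (c j * binarySequence (suc t) m j zero)
        ≡⟨ ∑-*-++ L R c (powersOfTwo L) (replicate R 0ℤ) ⟩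
      fromBinary L (c ∘ (_↑ˡ R)) + ∑[ j < R ] (c (L ↑ʳ j) * 0ℤ)
        ≡⟨ cong (λ z → fromBinary L (c ∘ (_↑ˡ R)) + z) (∑-*0 R (c ∘ (L ↑ʳ_))) ⟩
      fromBinary L (c ∘ (_↑ˡ R)) + 0ℤ
        ≡⟨ ℤ.+-identityʳ _ ⟩
      fromBinary L (c ∘ (_↑ˡ R)) ∎
      where open ≡.≡-Reasoning

    binarySequence-tail : ∀ i → signedSubsum (L ℕ.+ R) I a (binarySequence (suc t) m) (suc i) ≡
      signedSubsum R (I ∘ (L ↑ʳ_)) (a ∘ (L ↑ʳ_)) (binarySequence t (m ∘ suc)) i
    binarySequence-tail i = begin
      signedSubsum (L ℕ.+ R) I a (binarySequence (suc t) m) (suc i)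
        ≡⟨ signedSubsum-component (L ℕ.+ R) I a _ (suc i) ⟩
      ∑[ j < L ℕ.+ R ] (c j * binarySequence (suc t) m j (suc i))
        ≡⟨ ∑-*-++ L R c (replicate L 0ℤ) (λ j → binarySequence t (m ∘ suc) j i) ⟩
      ∑[ j < L ] (c (j ↑ˡ R) * 0ℤ) + ∑[ j < R ] (c (L ↑ʳ j) * binarySequence t (m ∘ suc) j i)
        ≡⟨ cong (_+ ∑[ j < R ] (c (L ↑ʳ j) * binarySequence t (m ∘ suc) j i)) (∑-*0 L (c ∘ (_↑ˡ R))) ⟩
      0ℤ + ∑[ j < R ] (c (L ↑ʳ j) * binarySequence t (m ∘ suc) j i)
        ≡⟨ ℤ.+-identityˡ _ ⟩
      ∑[ j < R ] (c (L ↑ʳ j) * binarySequence t (m ∘ suc) j i)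
        ≡⟨ signedSubsum-component R _ _ _ i ⟨
      signedSubsum R (I ∘ (L ↑ʳ_)) (a ∘ (L ↑ʳ_)) (binarySequence t (m ∘ suc)) i ∎
      where open ≡.≡-Reasoning

  binarySequence-zeroSumFree : ∀ t m → (∀ i → 1 ≤ m i) → PMZeroSumFree m (binarySequence t m)
  binarySequence-zeroSumFree (suc t) m m≥1 I a (j , Ij) sum≈0 with splitAt ⌊log₂ m zero ⌋ j in split-j
  ... | inj₁ j₁ = fromBinary≢0 L c′ ∣c′∣≤1 (j₁ , c′j₁≢0) (∣-small⇒≡0 m₀∣sum ∣sum∣<m₀)
    where
    L R : ℕ
    L = ⌊log₂ m zero ⌋
    R = binaryLength t (m ∘ suc)
    c′ : Fin L → ℤ
    c′ j = coefficient (I (j ↑ˡ R)) (a (j ↑ˡ R))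
    ∣c′∣≤1 : ∀ j → ∣ c′ j ∣ ≤ 1
    ∣c′∣≤1 j = ∣coefficient∣≤1 (I (j ↑ˡ R)) (a (j ↑ˡ R))
    c′j₁≢0 : c′ j₁ ≢ 0ℤ
    c′j₁≢0 = coefficient≢0 (a (j₁ ↑ˡ R)) (≡.subst (λ j → I j ≡ true) (≡.sym (splitAt⁻¹-↑ˡ split-j)) Ij)
    m₀∣sum : + m zero ∣ fromBinary L c′
    m₀∣sum = ∣-resp (≡.trans (ℤ.+-identityʳ _) (binarySequence-head t m I a)) (sum≈0 zero)
    ∣sum∣<m₀ : ∣ fromBinary L c′ ∣ < m zero
    ∣sum∣<m₀ = ℕ.<-≤-trans (∣fromBinary∣<2^k L c′ ∣c′∣≤1) (2^⌊log₂n⌋≤n (m zero) (m≥1 zero))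
  ... | inj₂ j₂ = binarySequence-zeroSumFree t (m ∘ suc) (m≥1 ∘ suc) (I ∘ (L ↑ʳ_)) (a ∘ (L ↑ʳ_))
    (j₂ , ≡.subst (λ j → I j ≡ true) (≡.sym (splitAt⁻¹-↑ʳ split-j)) Ij)
    (λ i → ∣-resp (cong (_- 0ℤ) (binarySequence-tail t m I a i)) (sum≈0 (suc i)))
    where
    L : ℕ
    L = ⌊log₂ m zero ⌋

open PowersOfTwo

module Pigeonhole where

  open import Data.Integer using (_-_)

  funToFin-cong : ∀ {m n} {f g : Fin m → Fin n} → (∀ x → f x ≡ g x) → funToFin f ≡ funToFin g
  funToFin-cong {zero}  f≗g = ≡.refl
  funToFin-cong {suc m} f≗g = cong₂ combine (f≗g zero) (funToFin-cong (f≗g ∘ suc))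

  subsets-pigeonhole : ∀ {k N} → N < 2 ^ k → (f : (Fin k → Bool) → Fin N) →
    ∃₂ λ S T → (∃ λ j → S j ≢ T j) × f S ≡ f T
  subsets-pigeonhole {k} N<2^k f =
    let i , j , i<j , fi≡fj = pigeonhole N<2^k (f ∘ subset) in
    subset i , subset j , ¬∀⟶∃¬ k _ (λ x → subset i x Bool.≟ subset j x) (distinct i<j) , fi≡fj
    where
    subset : Fin (2 ^ k) → Fin k → Bool
    subset i = Inverse.to 2↔Bool ∘ finToFun i
    distinct : ∀ {i j} → i Fin.< j → ¬ (∀ x → subset i x ≡ subset j x)
    distinct {i} {j} i<j same = Fin.<-irrefl i≡j i<j
      where
      open ≡.≡-Reasoning
      toBool-injective : ∀ {x y} → Inverse.to 2↔Bool x ≡ Inverse.to 2↔Bool y → x ≡ y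
      toBool-injective = Injection.injective (Inverse⇒Injection 2↔Bool)
      i≡j : i ≡ j
      i≡j = begin
        i                              ≡⟨ funToFin-finToFin {k} {2} i ⟨
        funToFin (finToFun {2} {k} i)  ≡⟨ funToFin-cong (toBool-injective ∘ same) ⟩
        funToFin (finToFun {2} {k} j)  ≡⟨ funToFin-finToFin {k} {2} j ⟩
        j                              ∎

  xor-≢ : ∀ {b c} → b ≢ c → b xor c ≡ true
  xor-≢ {true}  {true}  b≢c = contradiction ≡.refl b≢c
  xor-≢ {true}  {false} _   = ≡.refl
  xor-≢ {false} {true}  _   = ≡.refl
  xor-≢ {false} {false} b≢c = contradiction ≡.refl b≢c

  AllPMZero-pair : ∀ a b k .{{_ : NonZero a}} .{{_ : NonZero b}} →
    a ℕ.* b < 2 ^ k → AllPMZero (pairMod a b) k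
  AllPMZero-pair a b k ab<2^k g =
    let S , T , (j , Sj≢Tj) , same-code = subsets-pigeonhole ab<2^k code
        same-residue₀ , same-residue₁ = combine-injective _ _ _ _ same-code
        divides-difference : ∀ c → + pairMod a b c ∣ subsum k S g c - subsum k T g c
        divides-difference = λ
          { zero       → residue-≡⇒∣ a (subsum k S g zero) (subsum k T g zero) same-residue₀
          ; (suc zero) → residue-≡⇒∣ b (subsum k S g (suc zero)) (subsum k T g (suc zero)) same-residue₁ }
    in (λ j → S j xor T j) , (λ j → if S j then Sign.+ else Sign.-) , (j , xor-≢ Sj≢Tj) ,
       λ c → ∣-resp (≡.sym (≡.trans (ℤ.+-identityʳ _) (signedSubsum-xor k S T g c))) (divides-difference c)
    where
    code : (Fin k → Bool) → Fin (a ℕ.* b)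
    code R = combine (residue a (subsum k R g zero)) (residue b (subsum k R g (suc zero)))

open Pigeonhole

DpmAdmissible-pair : ∀ a b .{{_ : NonZero a}} .{{_ : NonZero b}} →
  DpmAdmissible (pairMod a b) (⌊log₂ (a ℕ.* b) ⌋ ℕ.+ 1)
DpmAdmissible-pair a b = ℕ.m≤n+m 1 _ , λ k ℓ≤k → AllPMZero-pair a b k (begin-strict
  a ℕ.* b                        <⟨ n<2^[1+⌊log₂n⌋] (a ℕ.* b) ⟩
  2 ^ suc ⌊log₂ (a ℕ.* b) ⌋      ≡⟨ cong (2 ^_) (ℕ.+-comm 1 ⌊log₂ (a ℕ.* b) ⌋) ⟩
  2 ^ (⌊log₂ (a ℕ.* b) ⌋ ℕ.+ 1)  ≤⟨ ℕ.^-monoʳ-≤ 2 ℓ≤k ⟩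
  2 ^ k                          ∎)
  where open ℕ.≤-Reasoning

Decomposition⇒¬AllPMZero : ∀ {s} {d : Fin s → ℕ} {t m} →
  Decomposition d t m → ¬ AllPMZero d (binaryLength t m)
Decomposition⇒¬AllPMZero {t = t} {m} (_ , m≥1 , φ) =
  PMZeroSumFree⇒¬AllPMZero (binarySequence t m) (binarySequence-zeroSumFree t m m≥1)
  ∘ AllPMZero-transport φ

dstarValue≤Dpm : ∀ {s} {d : Fin s → ℕ} {ℓ t m} →
  DpmAdmissible d ℓ → Decomposition d t m → dstarValue t m ≤ ℓ
dstarValue≤Dpm {ℓ = ℓ} {t} {m} (_ , allZero) decomposition =
  ≡.subst (_≤ ℓ) (ℕ.+-comm 1 (binaryLength t m))
    (ℕ.≰⇒> λ ℓ≤length → Decomposition⇒¬AllPMZero decomposition (allZero _ ℓ≤length))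

IsDstar×IsDpm : ∀ {s} {d : Fin s → ℕ} {ℓ t m} →
  Decomposition d t m → dstarValue t m ≡ ℓ → DpmAdmissible d ℓ → IsDstar d ℓ × IsDpm d ℓ
IsDstar×IsDpm {t = t} {m} decomposition value≡ℓ admissible =
  ((t , m , decomposition , value≡ℓ) , λ _ _ → dstarValue≤Dpm admissible) ,
  (admissible , λ _ admissible′ → ≡.subst (_≤ _) value≡ℓ (dstarValue≤Dpm admissible′ decomposition))

-- The inverse maps are the Chinese remainder maps: modulo a b, the first component of `to`
-- glues x₀ mod a with x₁ mod b using α a + β b = 1; modulo a b c, the second component of
-- `from` glues y₀ mod b with y₁ mod a c using u b + w a c = 1.
module CRT {a b c : ℕ} {α β γ δ : ℤ}
  (bézout-ab : α ℤ.* + a ℤ.+ β ℤ.* + b ≡ 1ℤ) (bézout-bc : γ ℤ.* + b ℤ.+ δ ℤ.* + c ≡ 1ℤ) where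

  open import Data.Integer using (_+_; _-_; _*_)

  private
    A B C u w : ℤ
    A = + a
    B = + b
    C = + c
    u = β * γ * B + β * δ * C + α * γ * A
    w = α * δ

    G H : Fin 2 → ℕ
    G = pairMod a (a ℕ.* b ℕ.* c)
    H = pairMod (a ℕ.* b) (a ℕ.* c)

  bézout-b-ac : u * B + w * (A * C) ≡ 1ℤ
  bézout-b-ac = ≡.trans (expand α β γ δ A B C) (cong₂ _*_ bézout-ab bézout-bc)
    where
    expand : ∀ α β γ δ A B C →
      (β * γ * B + β * δ * C + α * γ * A) * B + α * δ * (A * C) ≡ (α * A + β * B) * (γ * B + δ * C)
    expand = solve-∀

  to : Elem 2 → Elem 2
  to x zero       = β * B * x zero + α * A * x (suc zero)
  to x (suc zero) = x (suc zero)

  from : Elem 2 → Elem 2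
  from y zero       = y zero
  from y (suc zero) = w * (A * C) * y zero + u * B * y (suc zero)

  private
    +ab : + (a ℕ.* b) ≡ A * B
    +ab = ℤ.pos-* a b

    +ac : + (a ℕ.* c) ≡ A * C
    +ac = ℤ.pos-* a c

    +abc : + (a ℕ.* b ℕ.* c) ≡ A * B * C
    +abc = ≡.trans (ℤ.pos-* (a ℕ.* b) c) (cong (_* C) +ab)

    linear : ∀ p q x₀ y₀ x₁ y₁ → (p * x₀ + q * x₁) - (p * y₀ + q * y₁) ≡ p * (x₀ - y₀) + q * (x₁ - y₁)
    linear = solve-∀

    ∣-modulo-bézout : ∀ {d} D → + d ≡ D → ∀ {e} q k₁ k₂ →
      e ≡ q * D + k₁ * (α * A + β * B - 1ℤ) + k₂ * (u * B + w * (A * C) - 1ℤ) → + d ∣ e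
    ∣-modulo-bézout {d} D d≡D {e} q k₁ k₂ e≡ = ∣-witness D d≡D q (begin
      e                                                                    ≡⟨ e≡ ⟩
      q * D + k₁ * (α * A + β * B - 1ℤ) + k₂ * (u * B + w * (A * C) - 1ℤ)
        ≡⟨ cong₂ (λ s t → q * D + k₁ * (s - 1ℤ) + k₂ * (t - 1ℤ)) bézout-ab bézout-b-ac ⟩
      q * D + k₁ * (1ℤ - 1ℤ) + k₂ * (1ℤ - 1ℤ)                             ≡⟨ vanish q D k₁ k₂ ⟩
      q * D                                                                ∎)
      where
      open ≡.≡-Reasoning
      vanish : ∀ q D k₁ k₂ → q * D + k₁ * (1ℤ - 1ℤ) + k₂ * (1ℤ - 1ℤ) ≡ q * D
      vanish = solve-∀

    quotients-G : ∀ x y → x Defs.≈⟨ G ⟩ y →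
      ∃₂ λ q₀ q₁ → (x zero - y zero ≡ q₀ * A) × (x (suc zero) - y (suc zero) ≡ q₁ * (A * B * C))
    quotients-G x y x≈y =
      let q₀ , x₀-y₀≡ = quotient A ≡.refl _ (x≈y zero)
          q₁ , x₁-y₁≡ = quotient (A * B * C) +abc _ (x≈y (suc zero))
      in q₀ , q₁ , x₀-y₀≡ , x₁-y₁≡

    quotients-H : ∀ x y → x Defs.≈⟨ H ⟩ y →
      ∃₂ λ q₀ q₁ → (x zero - y zero ≡ q₀ * (A * B)) × (x (suc zero) - y (suc zero) ≡ q₁ * (A * C))
    quotients-H x y x≈y =
      let q₀ , x₀-y₀≡ = quotient (A * B) +ab _ (x≈y zero)
          q₁ , x₁-y₁≡ = quotient (A * C) +ac _ (x≈y (suc zero))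
      in q₀ , q₁ , x₀-y₀≡ , x₁-y₁≡

  to-cong : ∀ x y → x Defs.≈⟨ G ⟩ y → to x Defs.≈⟨ H ⟩ to y
  to-cong x y x≈y zero with q₀ , q₁ , x₀-y₀≡ , x₁-y₁≡ ← quotients-G x y x≈y =
    ∣-witness (A * B) +ab (β * q₀ + α * A * C * q₁) (begin
      to x zero - to y zero
        ≡⟨ linear (β * B) (α * A) (x zero) (y zero) (x (suc zero)) (y (suc zero)) ⟩
      β * B * (x zero - y zero) + α * A * (x (suc zero) - y (suc zero))
        ≡⟨ cong₂ (λ s t → β * B * s + α * A * t) x₀-y₀≡ x₁-y₁≡ ⟩
      β * B * (q₀ * A) + α * A * (q₁ * (A * B * C))
        ≡⟨ collect α β q₀ q₁ A B C ⟩
      (β * q₀ + α * A * C * q₁) * (A * B) ∎)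
    where
    open ≡.≡-Reasoning
    collect : ∀ α β q₀ q₁ A B C →
      β * B * (q₀ * A) + α * A * (q₁ * (A * B * C)) ≡ (β * q₀ + α * A * C * q₁) * (A * B)
    collect = solve-∀
  to-cong x y x≈y (suc zero) with _ , q₁ , _ , x₁-y₁≡ ← quotients-G x y x≈y =
    ∣-witness (A * C) +ac (q₁ * B) (≡.trans x₁-y₁≡ (collect q₁ A B C))
    where
    collect : ∀ q A B C → q * (A * B * C) ≡ q * B * (A * C)
    collect = solve-∀

  from-cong : ∀ x y → x Defs.≈⟨ H ⟩ y → from x Defs.≈⟨ G ⟩ from y
  from-cong x y x≈y zero with q₀ , _ , x₀-y₀≡ , _ ← quotients-H x y x≈y =
    ∣-witness A ≡.refl (q₀ * B) (≡.trans x₀-y₀≡ (collect q₀ A B))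
    where
    collect : ∀ q A B → q * (A * B) ≡ q * B * A
    collect = solve-∀
  from-cong x y x≈y (suc zero) with q₀ , q₁ , x₀-y₀≡ , x₁-y₁≡ ← quotients-H x y x≈y =
    ∣-witness (A * B * C) +abc (w * A * q₀ + u * q₁) (begin
      from x (suc zero) - from y (suc zero)
        ≡⟨ linear (w * (A * C)) (u * B) (x zero) (y zero) (x (suc zero)) (y (suc zero)) ⟩
      w * (A * C) * (x zero - y zero) + u * B * (x (suc zero) - y (suc zero))
        ≡⟨ cong₂ (λ s t → w * (A * C) * s + u * B * t) x₀-y₀≡ x₁-y₁≡ ⟩
      w * (A * C) * (q₀ * (A * B)) + u * B * (q₁ * (A * C))
        ≡⟨ collect u w q₀ q₁ A B C ⟩
      (w * A * q₀ + u * q₁) * (A * B * C) ∎)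
    where
    open ≡.≡-Reasoning
    collect : ∀ u w q₀ q₁ A B C →
      w * (A * C) * (q₀ * (A * B)) + u * B * (q₁ * (A * C)) ≡ (w * A * q₀ + u * q₁) * (A * B * C)
    collect = solve-∀

  to-hom : ∀ x y → to (x ⊕E y) Defs.≈⟨ H ⟩ (to x ⊕E to y)
  to-hom x y = componentwise (≈-pointwise additive)
    where
    open CyclicSum H using (componentwise; ≈-pointwise)
    distribute : ∀ p q x₀ x₁ y₀ y₁ → p * (x₀ + y₀) + q * (x₁ + y₁) ≡ (p * x₀ + q * x₁) + (p * y₀ + q * y₁)
    distribute = solve-∀
    additive : ∀ i → to (x ⊕E y) i ≡ (to x ⊕E to y) i
    additive zero       = distribute (β * B) (α * A) (x zero) (x (suc zero)) (y zero) (y (suc zero))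
    additive (suc zero) = ≡.refl

  from-to : ∀ x → from (to x) Defs.≈⟨ G ⟩ x
  from-to x zero =
    ∣-modulo-bézout A ≡.refl (α * (x₁ - x₀)) x₀ 0ℤ (identity α β u w A B C x₀ x₁)
    where
    x₀ x₁ : ℤ
    x₀ = x zero
    x₁ = x (suc zero)
    identity : ∀ α β u w A B C x₀ x₁ →
      (β * B * x₀ + α * A * x₁) - x₀ ≡
      α * (x₁ - x₀) * A + x₀ * (α * A + β * B - 1ℤ) + 0ℤ * (u * B + w * (A * C) - 1ℤ)
    identity = solve-∀
  from-to x (suc zero) =
    ∣-modulo-bézout (A * B * C) +abc (w * β * (x₀ - x₁)) (w * A * C * x₁) x₁ (identity α β u w A B C x₀ x₁)
    where
    x₀ x₁ : ℤ
    x₀ = x zero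
    x₁ = x (suc zero)
    identity : ∀ α β u w A B C x₀ x₁ →
      (w * (A * C) * (β * B * x₀ + α * A * x₁) + u * B * x₁) - x₁ ≡
      w * β * (x₀ - x₁) * (A * B * C) + w * A * C * x₁ * (α * A + β * B - 1ℤ) + x₁ * (u * B + w * (A * C) - 1ℤ)
    identity = solve-∀

  to-from : ∀ y → to (from y) Defs.≈⟨ H ⟩ y
  to-from y zero =
    ∣-modulo-bézout (A * B) +ab (α * u * (y₁ - y₀)) y₀ (y₀ * α * A) (identity α β u w A B C y₀ y₁)
    where
    y₀ y₁ : ℤ
    y₀ = y zero
    y₁ = y (suc zero)
    identity : ∀ α β u w A B C y₀ y₁ →
      (β * B * y₀ + α * A * (w * (A * C) * y₀ + u * B * y₁)) - y₀ ≡
      α * u * (y₁ - y₀) * (A * B) + y₀ * (α * A + β * B - 1ℤ) + y₀ * α * A * (u * B + w * (A * C) - 1ℤ)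
    identity = solve-∀
  to-from y (suc zero) =
    ∣-modulo-bézout (A * C) +ac (w * (y₀ - y₁)) 0ℤ y₁ (identity α β u w A B C y₀ y₁)
    where
    y₀ y₁ : ℤ
    y₀ = y zero
    y₁ = y (suc zero)
    identity : ∀ α β u w A B C y₀ y₁ →
      (w * (A * C) * y₀ + u * B * y₁) - y₁ ≡
      w * (y₀ - y₁) * (A * C) + 0ℤ * (α * A + β * B - 1ℤ) + y₁ * (u * B + w * (A * C) - 1ℤ)
    identity = solve-∀

  iso : GroupIso G H
  iso = record
    { to = to ; from = from ; to-cong = to-cong ; from-cong = from-cong
    ; to-hom = to-hom ; from-to = from-to ; to-from = to-from }

pairMod-CRT : ∀ {a b c} → Coprime a b → Coprime b c →
  GroupIso (pairMod a (a ℕ.* b ℕ.* c)) (pairMod (a ℕ.* b) (a ℕ.* c))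
pairMod-CRT a⊥b b⊥c =
  let α , β , bézout-ab = coprime-Bézoutℤ a⊥b
      γ , δ , bézout-bc = coprime-Bézoutℤ b⊥c
  in CRT.iso {α = α} {β} {γ} {δ} bézout-ab bézout-bc

-- Opened only here: earlier, these would clash with the ℤ operators opened in the modules above.
open import Data.Nat using (_+_; _*_)
import Data.Nat.Tactic.RingSolver as ℕ-Solver

⌊log₂[m*n]⌋≡⌊log₂m⌋+⌊log₂n⌋ : ∀ {m n} → 1 ≤ m → 1 ≤ n →
  m * n < 2 ^ suc (⌊log₂ m ⌋ + ⌊log₂ n ⌋) → ⌊log₂ (m * n) ⌋ ≡ ⌊log₂ m ⌋ + ⌊log₂ n ⌋
⌊log₂[m*n]⌋≡⌊log₂m⌋+⌊log₂n⌋ {m} {n} 1≤m 1≤n = ⌊log₂⌋-unique (begin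
  2 ^ (⌊log₂ m ⌋ + ⌊log₂ n ⌋)     ≡⟨ ℕ.^-distribˡ-+-* 2 ⌊log₂ m ⌋ ⌊log₂ n ⌋ ⟩
  2 ^ ⌊log₂ m ⌋ * 2 ^ ⌊log₂ n ⌋   ≤⟨ ℕ.*-mono-≤ (2^⌊log₂n⌋≤n m 1≤m) (2^⌊log₂n⌋≤n n 1≤n) ⟩
  m * n                           ∎)
  where open ℕ.≤-Reasoning

⌊log₂[m*n]⌋≡⌊log₂m⌋+⌊log₂n⌋+1 : ∀ m n → FracSumGe1 m n →
  ⌊log₂ (m * n) ⌋ ≡ ⌊log₂ m ⌋ + ⌊log₂ n ⌋ + 1
⌊log₂[m*n]⌋≡⌊log₂m⌋+⌊log₂n⌋+1 m n 2^[⌊log₂m⌋+⌊log₂n⌋+1]≤mn =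
  ⌊log₂⌋-unique 2^[⌊log₂m⌋+⌊log₂n⌋+1]≤mn (begin-strict
    m * n                                  <⟨ ℕ.*-mono-< (n<2^[1+⌊log₂n⌋] m) (n<2^[1+⌊log₂n⌋] n) ⟩
    2 ^ suc ⌊log₂ m ⌋ * 2 ^ suc ⌊log₂ n ⌋  ≡⟨ ℕ.^-distribˡ-+-* 2 (suc ⌊log₂ m ⌋) (suc ⌊log₂ n ⌋) ⟨
    2 ^ (suc ⌊log₂ m ⌋ + suc ⌊log₂ n ⌋)    ≡⟨ cong (2 ^_) (exponent ⌊log₂ m ⌋ ⌊log₂ n ⌋) ⟩
    2 ^ suc (⌊log₂ m ⌋ + ⌊log₂ n ⌋ + 1)    ∎)
  where
  open ℕ.≤-Reasoning
  exponent : ∀ x y → suc x + suc y ≡ suc (x + y + 1)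
  exponent = ℕ-Solver.solve-∀

⌊log₂[n²m₁m₂]⌋≡⌊log₂[nm₁]⌋+⌊log₂[nm₂]⌋ : ∀ {n m₁ m₂} → 1 ≤ n → 1 ≤ m₁ → 1 ≤ m₂ →
  FracSumGe1 m₁ n → FracSumGe1 m₂ n → FracCondLt3 m₁ m₂ n →
  ⌊log₂ (n * n * m₁ * m₂) ⌋ ≡ ⌊log₂ (n * m₁) ⌋ + ⌊log₂ (n * m₂) ⌋
⌊log₂[n²m₁m₂]⌋≡⌊log₂[nm₁]⌋+⌊log₂[nm₂]⌋ {n} {m₁} {m₂} 1≤n 1≤m₁ 1≤m₂ frac₁ frac₂ frac₃ =
  ≡.trans (cong ⌊log₂_⌋ (regroup n m₁ m₂))
    (⌊log₂[m*n]⌋≡⌊log₂m⌋+⌊log₂n⌋ (ℕ.*-mono-≤ 1≤n 1≤m₁) (ℕ.*-mono-≤ 1≤n 1≤m₂) (begin-strict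
      n * m₁ * (n * m₂)
        ≡⟨ reorder n m₁ m₂ ⟩
      m₁ * m₂ * (n * n)
        <⟨ frac₃ ⟩
      2 ^ (⌊log₂ m₁ ⌋ + ⌊log₂ m₂ ⌋ + 2 * ⌊log₂ n ⌋ + 3)
        ≡⟨ cong (2 ^_) (exponent ⌊log₂ m₁ ⌋ ⌊log₂ m₂ ⌋ ⌊log₂ n ⌋) ⟩
      2 ^ suc ((⌊log₂ m₁ ⌋ + ⌊log₂ n ⌋ + 1) + (⌊log₂ m₂ ⌋ + ⌊log₂ n ⌋ + 1))
        ≡⟨ cong₂ (λ x y → 2 ^ suc (x + y)) ⌊log₂[nm₁]⌋≡ ⌊log₂[nm₂]⌋≡ ⟨
      2 ^ suc (⌊log₂ (n * m₁) ⌋ + ⌊log₂ (n * m₂) ⌋) ∎))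
  where
  open ℕ.≤-Reasoning
  ⌊log₂[nm₁]⌋≡ : ⌊log₂ (n * m₁) ⌋ ≡ ⌊log₂ m₁ ⌋ + ⌊log₂ n ⌋ + 1
  ⌊log₂[nm₁]⌋≡ = ≡.trans (cong ⌊log₂_⌋ (ℕ.*-comm n m₁)) (⌊log₂[m*n]⌋≡⌊log₂m⌋+⌊log₂n⌋+1 m₁ n frac₁)
  ⌊log₂[nm₂]⌋≡ : ⌊log₂ (n * m₂) ⌋ ≡ ⌊log₂ m₂ ⌋ + ⌊log₂ n ⌋ + 1
  ⌊log₂[nm₂]⌋≡ = ≡.trans (cong ⌊log₂_⌋ (ℕ.*-comm n m₂)) (⌊log₂[m*n]⌋≡⌊log₂m⌋+⌊log₂n⌋+1 m₂ n frac₂)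
  regroup : ∀ n m₁ m₂ → n * n * m₁ * m₂ ≡ n * m₁ * (n * m₂)
  regroup = ℕ-Solver.solve-∀
  reorder : ∀ n m₁ m₂ → n * m₁ * (n * m₂) ≡ m₁ * m₂ * (n * n)
  reorder = ℕ-Solver.solve-∀
  exponent : ∀ a b c → a + b + 2 * c + 3 ≡ suc ((a + c + 1) + (b + c + 1))
  exponent = ℕ-Solver.solve-∀

theorem3p5 : (n m₁ m₂ : ℕ) →
    1 ≤ n → 1 ≤ m₁ → 1 ≤ m₂ →
    Coprime n m₁ → Coprime n m₂ → Coprime m₁ m₂ →
    FracSumGe1 m₁ n → FracSumGe1 m₂ n →
    FracCondLt3 m₁ m₂ n →
    IsDstar (pairMod n (n * m₁ * m₂)) (⌊log₂ (n * n * m₁ * m₂) ⌋ + 1) ×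
    IsDpm (pairMod n (n * m₁ * m₂)) (⌊log₂ (n * n * m₁ * m₂) ⌋ + 1)
theorem3p5 n m₁ m₂ 1≤n 1≤m₁ 1≤m₂ n⊥m₁ _ m₁⊥m₂ frac₁ frac₂ frac₃ =
  IsDstar×IsDpm decomposition value admissible
  where
  decomposition : Decomposition (pairMod n (n * m₁ * m₂)) 2 (pairMod (n * m₁) (n * m₂))
  decomposition =
    s≤s z≤n ,
    (λ { zero → ℕ.*-mono-≤ 1≤n 1≤m₁ ; (suc zero) → ℕ.*-mono-≤ 1≤n 1≤m₂ }) ,
    pairMod-CRT n⊥m₁ m₁⊥m₂

  value : dstarValue 2 (pairMod (n * m₁) (n * m₂)) ≡ ⌊log₂ (n * n * m₁ * m₂) ⌋ + 1
  value = cong (_+ 1) (≡.trans (cong (λ y → ⌊log₂ (n * m₁) ⌋ + y) (ℕ.+-identityʳ _))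
    (≡.sym (⌊log₂[n²m₁m₂]⌋≡⌊log₂[nm₁]⌋+⌊log₂[nm₂]⌋ 1≤n 1≤m₁ 1≤m₂ frac₁ frac₂ frac₃)))

  admissible : DpmAdmissible (pairMod n (n * m₁ * m₂)) (⌊log₂ (n * n * m₁ * m₂) ⌋ + 1)
  admissible = ≡.subst (λ N → DpmAdmissible (pairMod n (n * m₁ * m₂)) (⌊log₂ N ⌋ + 1))
    (reassociate n m₁ m₂)
    (DpmAdmissible-pair n (n * m₁ * m₂)
      {{ℕ.>-nonZero 1≤n}} {{ℕ.>-nonZero (ℕ.*-mono-≤ (ℕ.*-mono-≤ 1≤n 1≤m₁) 1≤m₂)}})
    where
    reassociate : ∀ n m₁ m₂ → n * (n * m₁ * m₂) ≡ n * n * m₁ * m₂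
    reassociate = ℕ-Solver.solve-∀
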